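{- A residuated lattice $A$ is Stone if and only if its reticulation $\mathcal{L}(A)$ is a Stone lattice.
   Context: A residuated lattice is an algebra $(A,\vee,\wedge,\odot,\rightarrow,0,1)$ with $(A,\vee,\wedge,0,1)$ a bounded lattice, $(A,\odot,1)$ a commutative monoid and $a\le b\rightarrow c$ iff $a\odot b\le c$. Write $a^n$ for the $n$-fold $\odot$-power. $\mathcal{L}(A)$ is the reticulation of $A$: the (unique up to isomorphism) bounded distributive lattice with a map $\lambda:A\to\mathcal{L}(A)$ such that for all $a,b$: $\lambda(a\odot b)=\lambda(a)\wedge\lambda(b)$; $\lambda(a\vee b)=\lambda(a)\vee\lambda(b)$; $\lambda(0)=0,\lambda(1)=1$; $\lambda$ surjective; $\lambda(a)\le\lambda(b)$ iff $a^n\le b$ for some $n\ge1$. For $M$ a bounded distributive lattice or a residuated lattice: $B(M)$ is the set of complemented elements of $M$; for $a\in M$, $a^{\top}=\{m\in M\mid m\vee a=1\}$; for $e\in M$, $\langle e\rangle$ is the filter of $M$ generated by $e$ (for a lattice, $\{m\mid e\le m\}$; for a residuated lattice, $\{m\mid e^n\le m \text{ for some } n\ge1\}$). $M$ is Stone iff for every $a\in M$ there is $e\in B(M)$ with $a^{\top}=\langle e\rangle$. -}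

module Defs where

open import Level using (Level; _⊔_; suc)
open import Data.Nat using (ℕ; zero; _≤_) renaming (suc to sucℕ)
open import Data.Product using (Σ; ∃; _×_; _,_)
open import Relation.Binary.PropositionalEquality using (_≡_)
open import Function.Bundles using (_⇔_)

record BoundedLattice (ℓ : Level) : Set (suc ℓ) where
  infixr 6 _∨_
  infixr 7 _∧_
  field
    Carrier : Set ℓ
    _∨_ _∧_ : Carrier → Carrier → Carrier
    ⊥ ⊤ : Carrier
    ∨-comm : ∀ x y → x ∨ y ≡ y ∨ x
    ∧-comm : ∀ x y → x ∧ y ≡ y ∧ x
    ∨-assoc : ∀ x y z → (x ∨ y) ∨ z ≡ x ∨ (y ∨ z)
    ∧-assoc : ∀ x y z → (x ∧ y) ∧ z ≡ x ∧ (y ∧ z)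
    ∨-absorbs-∧ : ∀ x y → x ∨ (x ∧ y) ≡ x
    ∧-absorbs-∨ : ∀ x y → x ∧ (x ∨ y) ≡ x
    ⊥-least : ∀ x → ⊥ ∧ x ≡ ⊥
    ⊤-greatest : ∀ x → x ∧ ⊤ ≡ x

  _≤L_ : Carrier → Carrier → Set ℓ
  x ≤L y = x ∧ y ≡ x

  Complemented : Carrier → Set ℓ
  Complemented e = Σ Carrier λ e' → (e ∨ e' ≡ ⊤) × (e ∧ e' ≡ ⊥)

  InTopAnn : Carrier → Carrier → Set ℓ
  InTopAnn a m = m ∨ a ≡ ⊤

record BoundedDistributiveLattice (ℓ : Level) : Set (suc ℓ) where
  field
    boundedLattice : BoundedLattice ℓ
  open BoundedLattice boundedLattice public
  field
    ∧-distrib-∨ : ∀ x y z → x ∧ (y ∨ z) ≡ (x ∧ y) ∨ (x ∧ z)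

  InPrincipal : Carrier → Carrier → Set ℓ
  InPrincipal e m = e ≤L m

  IsStone : Set ℓ
  IsStone = ∀ a → Σ Carrier λ e → Complemented e
              × (∀ m → InTopAnn a m ⇔ InPrincipal e m)

record ResiduatedLattice (ℓ : Level) : Set (suc ℓ) where
  infixr 7 _⊙_
  infixr 5 _⇒_
  field
    boundedLattice : BoundedLattice ℓ
  open BoundedLattice boundedLattice public
  field
    _⊙_ _⇒_ : Carrier → Carrier → Carrier
    ⊙-comm : ∀ x y → x ⊙ y ≡ y ⊙ x
    ⊙-assoc : ∀ x y z → (x ⊙ y) ⊙ z ≡ x ⊙ (y ⊙ z)
    ⊙-identityˡ : ∀ x → ⊤ ⊙ x ≡ x
    residuation : ∀ a b c → (a ≤L (b ⇒ c) ⇔ (a ⊙ b) ≤L c)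

  pow : Carrier → ℕ → Carrier
  pow a zero = ⊤
  pow a (sucℕ n) = a ⊙ pow a n

  -- filter generated by e : {m | e^n ≤ m for some n ≥ 1}
  InPrincipal : Carrier → Carrier → Set ℓ
  InPrincipal e m = Σ ℕ λ n → (1 ≤ n) × (pow e n ≤L m)

  IsStone : Set ℓ
  IsStone = ∀ a → Σ Carrier λ e → Complemented e
              × (∀ m → InTopAnn a m ⇔ InPrincipal e m)

record IsReticulation {a l : Level} (A : ResiduatedLattice a)
       (L : BoundedDistributiveLattice l)
       (λ' : ResiduatedLattice.Carrier A → BoundedDistributiveLattice.Carrier L)
       : Set (a ⊔ l) where
  private
    module A = ResiduatedLattice A
    module L = BoundedDistributiveLattice L
  field
    pres-⊙ : ∀ x y → λ' (x A.⊙ y) ≡ λ' x L.∧ λ' y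
    pres-∨ : ∀ x y → λ' (x A.∨ y) ≡ λ' x L.∨ λ' y
    pres-0 : λ' A.⊥ ≡ L.⊥
    pres-1 : λ' A.⊤ ≡ L.⊤
    surjective : ∀ y → Σ A.Carrier λ x → λ' x ≡ y
    order : ∀ x y → (λ' x L.≤L λ' y) ⇔ (Σ ℕ λ n → (1 ≤ n) × (A.pow x n A.≤L y))

-- The reticulation map λ preserves and reflects the relation x ∨ y = 1, so it
-- carries a^⊤ onto λ(a)^⊤, and by its order axiom it carries ⟨e⟩ onto ⟨λ e⟩.
-- It sends complemented elements to complemented elements, and every
-- complemented element of L lifts: if λ x and λ y are complements, then
-- x ∨ y = 1 and (x ⊙ y)^n = 0 for some n ≥ 1, so x^n and y^n are complements
-- in A (when u ∨ v = 1 one has u ∧ v ≤ u ⊙ v) with λ(x^n) = λ x.  Hence a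
-- Stone witness on either side maps to one on the other.
module Submission where

open import Defs
open import Level using (Level)
open import Algebra.Bundles using (CommutativeMonoid)
open import Algebra.Lattice.Bundles using (Lattice)
import Algebra.Lattice.Properties.Lattice as LatticeProperties
import Algebra.Properties.CommutativeSemigroup as CommutativeSemigroupProperties
import Relation.Binary.Lattice as OrderTheoretic
open import Data.Nat using (zero; suc; s≤s; z≤n) renaming (_≤_ to _≤ℕ_)
open import Data.Product using (Σ; _×_; _,_)
open import Function.Bundles using (_⇔_; mk⇔; Equivalence)
open import Function.Construct.Composition using (_⇔-∘_)
open import Function.Construct.Symmetry using (⇔-sym)
open import Relation.Binary.PropositionalEquality
  using (_≡_; refl; sym; trans; cong; cong₂; subst; isEquivalence; module ≡-Reasoning)
open Equivalence using (to; from)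

module BoundedLatticeProperties {ℓ : Level} (B : BoundedLattice ℓ) where
  open BoundedLattice B

  lattice : Lattice ℓ ℓ
  lattice = record
    { Carrier   = Carrier
    ; _≈_       = _≡_
    ; _∨_       = _∨_
    ; _∧_       = _∧_
    ; isLattice = record
      { isEquivalence = isEquivalence
      ; ∨-comm        = ∨-comm
      ; ∨-assoc       = ∨-assoc
      ; ∨-cong        = cong₂ _∨_
      ; ∧-comm        = ∧-comm
      ; ∧-assoc       = ∧-assoc
      ; ∧-cong        = cong₂ _∧_
      ; absorptive    = ∨-absorbs-∧ , ∧-absorbs-∨
      }
    }

  open LatticeProperties lattice public using (∧-idem)

  -- The library orders a lattice by x ≡ x ∧ y, the mirror image of _≤L_.
  private
    module ≤ = OrderTheoretic.Lattice (LatticeProperties.∨-∧-orderTheoreticLattice lattice)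

  ≤-refl : ∀ {x} → x ≤L x
  ≤-refl = sym ≤.refl

  ≤-reflexive : ∀ {x y} → x ≡ y → x ≤L y
  ≤-reflexive refl = ≤-refl

  ≤-trans : ∀ {x y z} → x ≤L y → y ≤L z → x ≤L z
  ≤-trans p q = sym (≤.trans (sym p) (sym q))

  ≤-antisym : ∀ {x y} → x ≤L y → y ≤L x → x ≡ y
  ≤-antisym p q = ≤.antisym (sym p) (sym q)

  x≤x∨y : ∀ x y → x ≤L (x ∨ y)
  x≤x∨y x y = sym (≤.x≤x∨y x y)

  y≤x∨y : ∀ x y → y ≤L (x ∨ y)
  y≤x∨y x y = sym (≤.y≤x∨y x y)

  ∨-least : ∀ {x y z} → x ≤L z → y ≤L z → (x ∨ y) ≤L z
  ∨-least p q = sym (≤.∨-least (sym p) (sym q))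

  x∧y≤x : ∀ x y → (x ∧ y) ≤L x
  x∧y≤x x y = sym (≤.x∧y≤x x y)

  x∧y≤y : ∀ x y → (x ∧ y) ≤L y
  x∧y≤y x y = sym (≤.x∧y≤y x y)

  ∧-greatest : ∀ {x y z} → x ≤L y → x ≤L z → x ≤L (y ∧ z)
  ∧-greatest p q = sym (≤.∧-greatest (sym p) (sym q))

  x≤⊥⇒x≡⊥ : ∀ {x} → x ≤L ⊥ → x ≡ ⊥
  x≤⊥⇒x≡⊥ {x} p = ≤-antisym p (⊥-least x)

  ⊤≤x⇒x≡⊤ : ∀ {x} → ⊤ ≤L x → x ≡ ⊤
  ⊤≤x⇒x≡⊤ {x} p = ≤-antisym (⊤-greatest x) p

module ResiduatedLatticeProperties {ℓ : Level} (A : ResiduatedLattice ℓ) where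
  open ResiduatedLattice A
  open BoundedLatticeProperties boundedLattice
  open ≡-Reasoning

  ⊙-identityʳ : ∀ x → x ⊙ ⊤ ≡ x
  ⊙-identityʳ x = trans (⊙-comm x ⊤) (⊙-identityˡ x)

  ⊙-commutativeMonoid : CommutativeMonoid ℓ ℓ
  ⊙-commutativeMonoid = record
    { Carrier = Carrier
    ; _≈_ = _≡_
    ; _∙_ = _⊙_
    ; ε   = ⊤
    ; isCommutativeMonoid = record
      { isMonoid = record
        { isSemigroup = record
          { isMagma = record { isEquivalence = isEquivalence ; ∙-cong = cong₂ _⊙_ }
          ; assoc   = ⊙-assoc
          }
        ; identity = ⊙-identityˡ , ⊙-identityʳ
        }
      ; comm = ⊙-comm
      }
    }

  open CommutativeSemigroupProperties (CommutativeMonoid.commutativeSemigroup ⊙-commutativeMonoid)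
    using (interchange)

  pow-distrib-⊙ : ∀ x y n → pow (x ⊙ y) n ≡ pow x n ⊙ pow y n
  pow-distrib-⊙ x y zero    = sym (⊙-identityˡ ⊤)
  pow-distrib-⊙ x y (suc n) =
    trans (cong ((x ⊙ y) ⊙_) (pow-distrib-⊙ x y n)) (interchange x y (pow x n) (pow y n))

  pow-⊤ : ∀ n → pow ⊤ n ≡ ⊤
  pow-⊤ zero    = refl
  pow-⊤ (suc n) = trans (⊙-identityˡ (pow ⊤ n)) (pow-⊤ n)

  ⊙-monoˡ-≤ : ∀ {x y} z → x ≤L y → (x ⊙ z) ≤L (y ⊙ z)
  ⊙-monoˡ-≤ {x} {y} z x≤y =
    to (residuation x z (y ⊙ z)) (≤-trans x≤y (from (residuation y z (y ⊙ z)) ≤-refl))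

  ⊙-monoʳ-≤ : ∀ {x y} z → x ≤L y → (z ⊙ x) ≤L (z ⊙ y)
  ⊙-monoʳ-≤ {x} {y} z x≤y =
    subst (_≤L (z ⊙ y)) (⊙-comm x z) (subst ((x ⊙ z) ≤L_) (⊙-comm y z) (⊙-monoˡ-≤ z x≤y))

  x⊙y≤x : ∀ x y → (x ⊙ y) ≤L x
  x⊙y≤x x y = subst ((x ⊙ y) ≤L_) (⊙-identityʳ x) (⊙-monoʳ-≤ x (⊤-greatest y))

  x⊙y≤y : ∀ x y → (x ⊙ y) ≤L y
  x⊙y≤y x y = subst (_≤L y) (⊙-comm y x) (x⊙y≤x y x)

  x⊙y≤x∧y : ∀ x y → (x ⊙ y) ≤L (x ∧ y)
  x⊙y≤x∧y x y = ∧-greatest (x⊙y≤x x y) (x⊙y≤y x y)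

  ⊙-distribʳ-∨ : ∀ x y z → (x ∨ y) ⊙ z ≡ (x ⊙ z) ∨ (y ⊙ z)
  ⊙-distribʳ-∨ x y z = ≤-antisym lhs≤rhs
    (∨-least (⊙-monoˡ-≤ z (x≤x∨y x y)) (⊙-monoˡ-≤ z (y≤x∨y x y)))
    where
    rhs : Carrier
    rhs = (x ⊙ z) ∨ (y ⊙ z)

    lhs≤rhs : ((x ∨ y) ⊙ z) ≤L rhs
    lhs≤rhs = to (residuation (x ∨ y) z rhs)
      (∨-least (from (residuation x z rhs) (x≤x∨y _ _))
               (from (residuation y z rhs) (y≤x∨y _ _)))

  ∨≡⊤⇒x∧y≤x⊙y : ∀ {x y} → x ∨ y ≡ ⊤ → (x ∧ y) ≤L (x ⊙ y)
  ∨≡⊤⇒x∧y≤x⊙y {x} {y} x∨y≡⊤ = subst (_≤L (x ⊙ y)) (sym x∧y≡split)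
    (∨-least (⊙-monoʳ-≤ x (x∧y≤y x y))
             (subst ((y ⊙ (x ∧ y)) ≤L_) (⊙-comm y x) (⊙-monoʳ-≤ y (x∧y≤x x y))))
    where
    x∧y≡split : x ∧ y ≡ (x ⊙ (x ∧ y)) ∨ (y ⊙ (x ∧ y))
    x∧y≡split = begin
      x ∧ y                         ≡⟨ ⊙-identityˡ (x ∧ y) ⟨
      ⊤ ⊙ (x ∧ y)                   ≡⟨ cong (_⊙ (x ∧ y)) x∨y≡⊤ ⟨
      (x ∨ y) ⊙ (x ∧ y)             ≡⟨ ⊙-distribʳ-∨ x y (x ∧ y) ⟩
      (x ⊙ (x ∧ y)) ∨ (y ⊙ (x ∧ y)) ∎

module ReticulationProperties
    {a l : Level} {A : ResiduatedLattice a} {L : BoundedDistributiveLattice l}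
    {λ' : ResiduatedLattice.Carrier A → BoundedDistributiveLattice.Carrier L}
    (R : IsReticulation A L λ') where
  private
    module A = ResiduatedLattice A
    module L = BoundedDistributiveLattice L
    module A≤ = BoundedLatticeProperties A.boundedLattice
    module L≤ = BoundedLatticeProperties L.boundedLattice
  open ResiduatedLatticeProperties A
  open IsReticulation R
  open ≡-Reasoning

  TopAnnIsPrincipalᴬ : A.Carrier → A.Carrier → Set a
  TopAnnIsPrincipalᴬ x e = ∀ m → A.InTopAnn x m ⇔ A.InPrincipal e m

  TopAnnIsPrincipalᴸ : L.Carrier → L.Carrier → Set l
  TopAnnIsPrincipalᴸ x e = ∀ m → L.InTopAnn x m ⇔ L.InPrincipal e m

  λ-pow : ∀ x {n} → 1 ≤ℕ n → λ' (A.pow x n) ≡ λ' x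
  λ-pow x {zero}        ()
  λ-pow x {suc zero}    _ = cong λ' (⊙-identityʳ x)
  λ-pow x {suc (suc n)} _ = begin
    λ' (x A.⊙ A.pow x (suc n))     ≡⟨ pres-⊙ x (A.pow x (suc n)) ⟩
    λ' x L.∧ λ' (A.pow x (suc n))  ≡⟨ cong (λ' x L.∧_) (λ-pow x {suc n} (s≤s z≤n)) ⟩
    λ' x L.∧ λ' x                  ≡⟨ L≤.∧-idem (λ' x) ⟩
    λ' x                           ∎

  λ-reflects-⊤ : ∀ {x} → λ' x ≡ L.⊤ → x ≡ A.⊤
  λ-reflects-⊤ {x} λx≡⊤ =
    let n , _ , ⊤ⁿ≤x = to (order A.⊤ x) (L≤.≤-reflexive (trans pres-1 (sym λx≡⊤)))
    in  A≤.⊤≤x⇒x≡⊤ (subst (A._≤L x) (pow-⊤ n) ⊤ⁿ≤x)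

  ∨≡⊤⇔λ∨λ≡⊤ : ∀ x y → (x A.∨ y ≡ A.⊤) ⇔ (λ' x L.∨ λ' y ≡ L.⊤)
  ∨≡⊤⇔λ∨λ≡⊤ x y = mk⇔
    (λ x∨y≡⊤ → trans (sym (pres-∨ x y)) (trans (cong λ' x∨y≡⊤) pres-1))
    (λ λx∨λy≡⊤ → λ-reflects-⊤ (trans (pres-∨ x y) λx∨λy≡⊤))

  λ-complemented : ∀ {e} → A.Complemented e → L.Complemented (λ' e)
  λ-complemented {e} (e' , e∨e'≡⊤ , e∧e'≡⊥) = λ' e' , to (∨≡⊤⇔λ∨λ≡⊤ e e') e∨e'≡⊤ , λe∧λe'≡⊥
    where
    e⊙e'≡⊥ : e A.⊙ e' ≡ A.⊥
    e⊙e'≡⊥ = A≤.x≤⊥⇒x≡⊥ (subst ((e A.⊙ e') A.≤L_) e∧e'≡⊥ (x⊙y≤x∧y e e'))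

    λe∧λe'≡⊥ : λ' e L.∧ λ' e' ≡ L.⊥
    λe∧λe'≡⊥ = trans (sym (pres-⊙ e e')) (trans (cong λ' e⊙e'≡⊥) pres-0)

  lift-complemented : ∀ {f} → L.Complemented f → Σ A.Carrier λ e → A.Complemented e × λ' e ≡ f
  lift-complemented {f} (f' , f∨f'≡⊤ , f∧f'≡⊥) with surjective f | surjective f'
  ... | x , refl | y , refl with to (order (x A.⊙ y) A.⊥) λ[x⊙y]≤λ⊥
    where
    λ[x⊙y]≤λ⊥ : λ' (x A.⊙ y) L.≤L λ' A.⊥
    λ[x⊙y]≤λ⊥ = L≤.≤-reflexive (trans (pres-⊙ x y) (trans f∧f'≡⊥ (sym pres-0)))
  ...   | n , 1≤n , [x⊙y]ⁿ≤⊥ = e , (e' , e∨e'≡⊤ , e∧e'≡⊥) , λ-pow x 1≤n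
    where
    e e' : A.Carrier
    e  = A.pow x n
    e' = A.pow y n

    e∨e'≡⊤ : e A.∨ e' ≡ A.⊤
    e∨e'≡⊤ = from (∨≡⊤⇔λ∨λ≡⊤ e e') (trans (cong₂ L._∨_ (λ-pow x 1≤n) (λ-pow y 1≤n)) f∨f'≡⊤)

    e∧e'≡⊥ : e A.∧ e' ≡ A.⊥
    e∧e'≡⊥ = A≤.x≤⊥⇒x≡⊥ (A≤.≤-trans (∨≡⊤⇒x∧y≤x⊙y e∨e'≡⊤)
                                    (subst (A._≤L A.⊥) (pow-distrib-⊙ x y n) [x⊙y]ⁿ≤⊥))

  topAnnIsPrincipal⇔ : ∀ x e → TopAnnIsPrincipalᴬ x e ⇔ TopAnnIsPrincipalᴸ (λ' x) (λ' e)
  topAnnIsPrincipal⇔ x e = mk⇔ down up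
    where
    down : TopAnnIsPrincipalᴬ x e → TopAnnIsPrincipalᴸ (λ' x) (λ' e)
    down x⊤≐⟨e⟩ μ with surjective μ
    ... | m , refl = ⇔-sym (order e m) ⇔-∘ (x⊤≐⟨e⟩ m ⇔-∘ ⇔-sym (∨≡⊤⇔λ∨λ≡⊤ m x))

    up : TopAnnIsPrincipalᴸ (λ' x) (λ' e) → TopAnnIsPrincipalᴬ x e
    up λx⊤≐⟨λe⟩ m = order e m ⇔-∘ (λx⊤≐⟨λe⟩ (λ' m) ⇔-∘ ∨≡⊤⇔λ∨λ≡⊤ m x)

  stone⇒stone : A.IsStone → L.IsStone
  stone⇒stone stoneA α with surjective α
  ... | x , refl =
    let e , e-complemented , x⊤≐⟨e⟩ = stoneA x
    in  λ' e , λ-complemented e-complemented , to (topAnnIsPrincipal⇔ x e) x⊤≐⟨e⟩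

  stone⇐stone : L.IsStone → A.IsStone
  stone⇐stone stoneL x with stoneL (λ' x)
  ... | f , f-complemented , λx⊤≐⟨f⟩ with lift-complemented f-complemented
  ...   | e , e-complemented , refl = e , e-complemented , from (topAnnIsPrincipal⇔ x e) λx⊤≐⟨f⟩

mainTheorem10 : {a l : Level} (A : ResiduatedLattice a) (L : BoundedDistributiveLattice l)
                (λ' : ResiduatedLattice.Carrier A → BoundedDistributiveLattice.Carrier L) →
                IsReticulation A L λ' →
                (ResiduatedLattice.IsStone A ⇔ BoundedDistributiveLattice.IsStone L)
mainTheorem10 A L λ' R = mk⇔ stone⇒stone stone⇐stone
  where open ReticulationProperties R
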